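{- Let $M$ be a quadratic c-monoid. Then $M$ is Koszul if and only if the Möbius species $M^{ -1}$ is Cohen–Macaulay.
   Context: Fix a field $\mathbb{K}$ of characteristic $0$. A set species is a functor from finite sets and bijections to finite sets; $(M\cdot N)[U]=\biguplus_{U_1\uplus U_2=U}M[U_1]\times N[U_2]$. A c-monoid is a set species $M$ with $M[\emptyset]=\{e\}$ and associative natural $\nu:M\cdot M\to M$ with unit $e$, satisfying left cancellation ($\nu(m_1,m_2)=\nu(m_1,m_2')\Rightarrow m_2=m_2'$). Order on $\biguplus_{U_1\subseteq U}M[U_1]$: $m_1\le_\nu m_2$ ($m_i\in M[U_i]$) if $U_1\subseteq U_2$ and $\nu(m_1,m')=m_2$ for some $m'\in M[U_2\setminus U_1]$; $\hat0=e$. The Möbius species $M^{ -1}$ assigns to $U$ the family of intervals $\{[\hat0,m]: m\in M[U]\}$, with bijections acting through $M$. A c-monoid is quadratic if its linearization $\mathbb K M$ (basis $M[U]$, product extending $\nu$) is a quadratic monoid $\mathcal M(F,R)=\mathbb L(F)/\langle R\rangle$ ($\mathbb L(F)=\sum_kF^k$ with tensor-species product $(F\cdot G)[U]=\bigoplus_{U_1\uplus U_2=U}F[U_1]\otimes G[U_2]$, $R\subseteq F^2$, $\langle R\rangle^{\underline k}=\sum_iF^iRF^{k-2-i}$), with grading $M^{\underline k}=F^k/\langle R\rangle^{\underline k}$ spanned by subsets of $M[U]$. $M$ is Koszul if the bar complex $\mathcal B\mathrm{ar}(M)$ — underlying species $\mathbb L(M_+)$, $m_1\otimes\cdots\otimes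 m_r$ ($m_i$ of degree $j_i\ge1$) in degree $\sum j_i-r$, differential $\sum_{i=1}^{r-1}(-1)^{i-1}m_1\otimes\cdots\otimes\nu(m_i\otimes m_{i+1})\otimes\cdots\otimes m_r$ — has cohomology concentrated in degree $0$. Poset homology: $\Delta_l(P)$ = chains $x_0<\cdots<x_l$ from a minimal to a maximal element, $\partial$ deletes an interior $x_i$ with sign $(-1)^{i-1}$, $H_*(P,\mathbb K)$ its homology. A graded poset (bounded, all maximal chains of each interval of equal length) is Cohen–Macaulay over $\mathbb K$ if every interval $[x,y]$ has $H_r([x,y],\mathbb K)=0$ for $r\ne\mathrm{rk}[x,y]$. A Möbius species is Cohen–Macaulay if all posets in all its values are Cohen–Macaulay. -}

module Defs where

open import Level using (Level; _⊔_) renaming (suc to lsuc; zero to lzero)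
open import Data.Nat using (ℕ; zero; suc; _+_; _≤_)
open import Data.Bool using (Bool; true; false; if_then_else_)
import Data.Bool as Bool
open import Data.Fin using (Fin)
import Data.Fin as Fin
open import Data.Fin.Subset using (Subset; ⊥; _∩_; _∪_; _∈_; ⋃)
open import Data.Fin.Subset.Properties using (x∈p∪q⁺)
open import Data.List using (List; []; _∷_; map; concatMap; foldr; length; _++_; drop)
open import Data.Empty renaming (⊥ to Empty)
open import Data.Unit using (⊤)
open import Data.Nat.ListAction using (sum)
open import Data.List.Relation.Unary.All using (All)
open import Data.List.Relation.Unary.AllPairs using (AllPairs)
import Data.List.Properties as ListP
import Data.Vec.Properties as VecP
import Data.Product.Properties as ProdP
open import Data.Product using (Σ; _×_; _,_; proj₁; proj₂)
open import Data.Sum using (inj₁; inj₂)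
open import Relation.Nullary using (¬_; does; yes; no)
open import Relation.Binary.PropositionalEquality using (_≡_; _≢_; subst)
open import Relation.Binary.Definitions using (DecidableEquality)
open import Function.Bundles using (_↔_; Inverse)
open import Algebra.Bundles using (CommutativeRing)

record Field (c ℓ : Level) : Set (lsuc (c ⊔ ℓ)) where
  field
    commutativeRing : CommutativeRing c ℓ
  open CommutativeRing commutativeRing public
  field
    0≉1     : ¬ (0# ≈ 1#)
    inverse : ∀ x → ¬ (x ≈ 0#) → Σ Carrier (λ y → (x * y) ≈ 1#)

module _ {c ℓ : Level} (K : Field c ℓ) where
  open Field K renaming (_+_ to _⊕_; _*_ to _⊛_)

  ℕ→K : ℕ → Carrier
  ℕ→K zero    = 0#
  ℕ→K (suc n) = 1# ⊕ ℕ→K n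

  CharZero : Set ℓ
  CharZero = ∀ n → ¬ (ℕ→K (suc n) ≈ 0#)

-- A finite set is modelled as a subset U of some Fin n;
-- its elements are  Elem U.  The category of such objects and all
-- bijections between their element types is equivalent to the category
-- of finite sets and bijections.  A decomposition U₁ ⊎ U₂ = U is a pair
-- of disjoint subsets with union U.

Elem : ∀ {n} → Subset n → Set
Elem {n} U = Σ (Fin n) (λ i → i ∈ U)

inclL : ∀ {n} {A B : Subset n} → Elem A → Elem (A ∪ B)
inclL (i , p) = i , x∈p∪q⁺ (inj₁ p)

inclR : ∀ {n} {A B : Subset n} → Elem B → Elem (A ∪ B)
inclR (i , p) = i , x∈p∪q⁺ (inj₂ p)

_≟ˢ_ : ∀ {n} → DecidableEquality (Subset n)
_≟ˢ_ = VecP.≡-dec Bool._≟_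

record SetSpecies : Set₁ where
  field
    size : ∀ {n} → Subset n → ℕ
  Car : ∀ {n} → Subset n → Set
  Car U = Fin (size U)
  field
    act      : ∀ {n m} {U : Subset n} {V : Subset m} →
               Elem U ↔ Elem V → Car U → Car V
    act-id   : ∀ {n} {U : Subset n} (σ : Elem U ↔ Elem U) →
               (∀ e → Inverse.to σ e ≡ e) → ∀ x → act σ x ≡ x
    act-comp : ∀ {n m k} {U : Subset n} {V : Subset m} {W : Subset k}
               (σ : Elem U ↔ Elem V) (τ : Elem V ↔ Elem W) (ρ : Elem U ↔ Elem W) →
               (∀ e → Inverse.to ρ e ≡ Inverse.to τ (Inverse.to σ e)) →
               ∀ x → act ρ x ≡ act τ (act σ x)

record CMonoid : Set₁ where
  field
    species : SetSpecies
  open SetSpecies species public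
  field
    e        : ∀ {n} → Car (⊥ {n})
    e-unique : ∀ {n} (x : Car (⊥ {n})) → x ≡ e
    -- ν : M · M → M ; on the summand U₁ ⊎ U₂ = U
    ν        : ∀ {n} (A B : Subset n) → A ∩ B ≡ ⊥ → Car A → Car B → Car (A ∪ B)
    ν-natural : ∀ {n m} {A B : Subset n} {A' B' : Subset m}
                (p : A ∩ B ≡ ⊥) (p' : A' ∩ B' ≡ ⊥)
                (σ : Elem (A ∪ B) ↔ Elem (A' ∪ B'))
                (α : Elem A ↔ Elem A') (β : Elem B ↔ Elem B') →
                (∀ x → proj₁ (Inverse.to α x) ≡ proj₁ (Inverse.to σ (inclL x))) →
                (∀ x → proj₁ (Inverse.to β x) ≡ proj₁ (Inverse.to σ (inclR x))) →
                ∀ a b → act σ (ν A B p a b) ≡ ν A' B' p' (act α a) (act β b)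
    unitˡ : ∀ {n} (A : Subset n) (p : ⊥ ∩ A ≡ ⊥) (q : ⊥ ∪ A ≡ A) (a : Car A) →
            subst Car q (ν ⊥ A p e a) ≡ a
    unitʳ : ∀ {n} (A : Subset n) (p : A ∩ ⊥ ≡ ⊥) (q : A ∪ ⊥ ≡ A) (a : Car A) →
            subst Car q (ν A ⊥ p a e) ≡ a
    assoc : ∀ {n} (A B C : Subset n)
            (pAB : A ∩ B ≡ ⊥) (pABC : (A ∪ B) ∩ C ≡ ⊥)
            (pBC : B ∩ C ≡ ⊥) (pA-BC : A ∩ (B ∪ C) ≡ ⊥)
            (q : (A ∪ B) ∪ C ≡ A ∪ (B ∪ C)) (a : Car A) (b : Car B) (c : Car C) →
            subst Car q (ν (A ∪ B) C pABC (ν A B pAB a b) c)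
              ≡ ν A (B ∪ C) pA-BC a (ν B C pBC b c)
    cancelˡ : ∀ {n} (A B : Subset n) (p : A ∩ B ≡ ⊥) (a : Car A) (b b' : Car B) →
              ν A B p a b ≡ ν A B p a b' → b ≡ b'

module CM (M : CMonoid) where
  open CMonoid M

  Pt : ℕ → Set
  Pt n = Σ (Subset n) Car

  _≟ᵖ_ : ∀ {n} → DecidableEquality (Pt n)
  _≟ᵖ_ = ProdP.≡-dec _≟ˢ_ Fin._≟_

  _≟ᵗ_ : ∀ {n} → DecidableEquality (List (Pt n))
  _≟ᵗ_ = ListP.≡-dec _≟ᵖ_

  0̂ : ∀ {n} → Pt n
  0̂ = ⊥ , e

  -- product of two points (only ever used on disjoint supports; on
  -- non-disjoint supports, where M · M has no summand, it returns 0̂)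
  mul : ∀ {n} → Pt n → Pt n → Pt n
  mul (A , a) (B , b) with (A ∩ B) ≟ˢ ⊥
  ... | yes p = A ∪ B , ν A B p a b
  ... | no  _ = 0̂

  prod : ∀ {n} → List (Pt n) → Pt n
  prod = foldr mul 0̂

  Part : ∀ {n} → Subset n → List (Pt n) → Set
  Part U t = AllPairs (λ x y → proj₁ x ∩ proj₁ y ≡ ⊥) t × ⋃ (map proj₁ t) ≡ U

  _≤ν_ : ∀ {n} → Pt n → Pt n → Set
  _≤ν_ {n} (A , a) (B , b) =
    Σ (Subset n) λ C → Σ (A ∩ C ≡ ⊥) λ p → Σ (A ∪ C ≡ B) λ q →
      Σ (Car C) λ m' → subst Car q (ν A C p a m') ≡ b

  _<ν_ : ∀ {n} → Pt n → Pt n → Set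
  x <ν y = x ≤ν y × x ≢ y

module Lin {c ℓ : Level} (K : Field c ℓ) where
  open Field K renaming (_+_ to _⊕_; _*_ to _⊛_)

  Comb : Set → Set c
  Comb X = List (Carrier × X)

  coeff : ∀ {X : Set} → DecidableEquality X → Comb X → X → Carrier
  coeff _≟_ []              x = 0#
  coeff _≟_ ((k , y) ∷ cs)  x = if does (y ≟ x) then k ⊕ coeff _≟_ cs x else coeff _≟_ cs x

  Eqᶜ : ∀ {X : Set} → DecidableEquality X → Comb X → Comb X → Set ℓ
  Eqᶜ _≟_ u v = ∀ x → coeff _≟_ u x ≈ coeff _≟_ v x

  lin : ∀ {X Y : Set} → (X → Comb Y) → Comb X → Comb Y
  lin f = concatMap (λ kx → map (λ ly → (proj₁ kx ⊛ proj₁ ly , proj₂ ly)) (f (proj₂ kx)))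

  scale : ∀ {X : Set} → Carrier → Comb X → Comb X
  scale k = map (λ ly → (k ⊛ proj₁ ly , proj₂ ly))

  alt : ∀ {X : Set} → Carrier → List X → Comb X
  alt s []       = []
  alt s (x ∷ xs) = (s , x) ∷ alt (- s) xs

  merges : ∀ {X : Set} → (X → X → X) → List X → List (List X)
  merges f []           = []
  merges f (x ∷ [])     = []
  merges f (x ∷ y ∷ zs) = (f x y ∷ zs) ∷ map (x ∷_) (merges f (y ∷ zs))

  -- deletions of x_1 .. x_{l-1} from x_0 ... x_l
  delButLast : ∀ {X : Set} → List X → List (List X)
  delButLast []           = []
  delButLast (y ∷ [])     = []
  delButLast (y ∷ z ∷ zs) = (z ∷ zs) ∷ map (y ∷_) (delButLast (z ∷ zs))

  interiorFaces : ∀ {X : Set} → List X → List (List X)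
  interiorFaces []       = []
  interiorFaces (x ∷ xs) = map (x ∷_) (delButLast xs)

module MoebiusCM {c ℓ : Level} (K : Field c ℓ) (M : CMonoid) where
  open Field K renaming (_+_ to _⊕_; _*_ to _⊛_)
  open Lin K
  open CMonoid M
  open CM M

  -- x_0 < x_1 < ... < x_l = y, given the list x_1 ... x_l
  StrictPath : ∀ {n} → Pt n → Pt n → List (Pt n) → Set
  StrictPath x y []       = x ≡ y
  StrictPath x y (z ∷ zs) = x <ν z × StrictPath z y zs

  ChainIn : ∀ {n} → Pt n → Pt n → ℕ → List (Pt n) → Set
  ChainIn x y l []       = Empty
  ChainIn x y l (z ∷ zs) = z ≡ x × length zs ≡ l × StrictPath z y zs

  _⋖_ : ∀ {n} → Pt n → Pt n → Set
  _⋖_ {n} a b = a <ν b × (∀ (z : Pt n) → ¬ (a <ν z × z <ν b))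

  SatPath : ∀ {n} → Pt n → List (Pt n) → Set
  SatPath x []       = ⊤
  SatPath x (z ∷ zs) = x ⋖ z × SatPath z zs

  MaxChainIn : ∀ {n} → Pt n → Pt n → ℕ → List (Pt n) → Set
  MaxChainIn x y l ch = ChainIn x y l ch × SatPath x (drop 1 ch)

  ∂ : ∀ {n} → List (Pt n) → Comb (List (Pt n))
  ∂ ch = alt 1# (interiorFaces ch)

  HomologyVanishes : ∀ {n} → Pt n → Pt n → ℕ → Set (c ⊔ ℓ)
  HomologyVanishes {n} x y r =
    ∀ (z : Comb (List (Pt n))) →
      All (λ kt → ChainIn x y r (proj₂ kt)) z →
      Eqᶜ _≟ᵗ_ (lin ∂ z) [] →
      Σ (Comb (List (Pt n))) λ b →
        All (λ kt → ChainIn x y (suc r) (proj₂ kt)) b × Eqᶜ _≟ᵗ_ (lin ∂ b) z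

  GradedOfRank : ∀ {n} → Pt n → Pt n → ℕ → Set
  GradedOfRank {n} x y ρ = ∀ (l : ℕ) (ch : List (Pt n)) → MaxChainIn x y l ch → l ≡ ρ

  IntervalCM : ∀ {n} → Pt n → Set (c ⊔ ℓ)
  IntervalCM {n} m =
    ∀ (x y : Pt n) → 0̂ ≤ν x → x ≤ν y → y ≤ν m →
      Σ ℕ λ ρ → GradedOfRank x y ρ × (∀ r → r ≢ ρ → HomologyVanishes x y r)

  CohenMacaulay : Set (c ⊔ ℓ)
  CohenMacaulay = ∀ {n} (U : Subset n) (m : Car U) → IntervalCM (U , m)

module Quad {c ℓ : Level} (K : Field c ℓ) (M : CMonoid) where
  open Field K renaming (_+_ to _⊕_; _*_ to _⊛_)
  open Lin K
  open CMonoid M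
  open CM M

  -- data of a grading  M^k  spanned by a subset of each M[U]
  record Grading : Set₁ where
    field
      deg     : ∀ {n} {U : Subset n} → Car U → ℕ
      deg-act : ∀ {n m} {U : Subset n} {V : Subset m} (σ : Elem U ↔ Elem V) (a : Car U) →
                deg (act σ a) ≡ deg a
      deg-ν   : ∀ {n} (A B : Subset n) (p : A ∩ B ≡ ⊥) (a : Car A) (b : Car B) →
                deg (ν A B p a b) ≡ deg a + deg b
      deg-e   : ∀ {n} → deg (e {n}) ≡ 0

    degP : ∀ {n} → Pt n → ℕ
    degP (A , a) = deg a

    Deg1 : ∀ {n} → Pt n → Set
    Deg1 x = degP x ≡ 1

    -- basis elements of F^k[U], F = K M^1 : ordered decompositions of U
    -- decorated by degree-one elements
    FBasis : ∀ {n} → Subset n → ℕ → List (Pt n) → Set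
    FBasis U k t = Part U t × length t ≡ k × All Deg1 t

    μ : ∀ {n} → Comb (List (Pt n)) → Comb (Pt n)
    μ = map (λ kt → proj₁ kt , prod (proj₂ kt))

    -- a generator  s ⊗ r ⊗ t  of the ideal generated by R = ker(μ : F² → K M)
    record IdealGen {n} (U : Subset n) (k : ℕ) : Set c where
      field
        s : List (Pt n)
        r : Comb (List (Pt n))
        t : List (Pt n)
    expand : ∀ {n} {U : Subset n} {k : ℕ} → IdealGen U k → Comb (List (Pt n))
    expand g = map (λ ku → proj₁ ku , IdealGen.s g ++ proj₂ ku ++ IdealGen.t g) (IdealGen.r g)

    ValidGen : ∀ {n} {U : Subset n} {k : ℕ} → IdealGen U k → Set (c ⊔ ℓ)
    ValidGen {n} {U} {k} g =
      All Deg1 (IdealGen.s g) × All Deg1 (IdealGen.t g) ×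
      All (λ ku → Part U (IdealGen.s g ++ proj₂ ku ++ IdealGen.t g) × length (proj₂ ku) ≡ 2
                  × All Deg1 (proj₂ ku)) (IdealGen.r g) ×
      length (IdealGen.s g) + 2 + length (IdealGen.t g) ≡ k ×
      Eqᶜ _≟ᵖ_ (μ (IdealGen.r g)) []

    -- membership in ⟨R⟩^k [U] = Σ_i F^i R F^(k-2-i) [U]
    InIdeal : ∀ {n} (U : Subset n) (k : ℕ) → Comb (List (Pt n)) → Set (c ⊔ ℓ)
    InIdeal U k z =
      Σ (List (Carrier × IdealGen U k)) λ gs →
        All (λ kg → ValidGen (proj₂ kg)) gs ×
        Eqᶜ _≟ᵗ_ z (concatMap (λ kg → scale (proj₁ kg) (expand (proj₂ kg))) gs)

  -- M is quadratic with respect to the grading: K M ≅ M(F,R) with F = K M^1,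
  -- R = ker(F² → K M), the isomorphism being induced by the product.
  record Quadratic : Set (lsuc lzero ⊔ c ⊔ ℓ) where
    field
      grading : Grading
    open Grading grading public
    field
      -- μ : F^k → M^k is onto (every element of degree k is a product of
      -- k elements of degree one)
      generated : ∀ {n} (U : Subset n) (m : Car U) →
                  Σ (List (Pt n)) λ t → FBasis U (deg m) t × prod t ≡ (U , m)
      -- ker (μ : F^k → K M) = ⟨R⟩^k
      relations : ∀ {n} (U : Subset n) (k : ℕ) (z : Comb (List (Pt n))) →
                  All (λ kt → FBasis U k (proj₂ kt)) z →
                  Eqᶜ _≟ᵖ_ (μ z) [] → InIdeal U k z

  module _ (Q : Quadratic) where
    open Quadratic Q

    -- basis of Bar(M)[U] in degree d: m_1 ⊗ ... ⊗ m_r with m_i ∈ M_+[U_i]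
    -- (deg m_i ≥ 1), U = U_1 ⊎ ... ⊎ U_r and Σ deg m_i - r = d
    BarBasis : ∀ {n} → Subset n → ℕ → List (Pt n) → Set
    BarBasis U d t = Part U t × All (λ x → 1 ≤ degP x) t × sum (map degP t) ≡ d + length t

    barDiff : ∀ {n} → List (Pt n) → Comb (List (Pt n))
    barDiff t = alt 1# (merges mul t)

    -- cohomology of Bar(M) vanishes in every degree d = suc k ≠ 0
    Koszul : Set (c ⊔ ℓ)
    Koszul = ∀ {n} (U : Subset n) (k : ℕ) (z : Comb (List (Pt n))) →
      All (λ kt → BarBasis U (suc k) (proj₂ kt)) z →
      Eqᶜ _≟ᵗ_ (lin barDiff z) [] →
      Σ (Comb (List (Pt n))) λ b →
        All (λ kt → BarBasis U k (proj₂ kt)) b × Eqᶜ _≟ᵗ_ (lin barDiff b) z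

module Submission where

-- A list t = w₁ ⋯ w_r of elements with pairwise disjoint supports, disjoint
-- from that of x, is an admissible walk from x; it determines the chain
-- x < x·w₁ < x·w₁w₂ < ⋯ of M (when all deg w_i > 0), and every strict chain
-- starting at x arises from exactly one such walk (left cancellation).  By
-- associativity, merging w_i with w_{i+1} deletes the i-th interior point of
-- the chain, so `chainOf x` turns the bar differential into the simplicial
-- boundary ∂; and the bar differential does not move the endpoint x·w₁⋯w_r.
-- Hence, for y = x·w₀, the walks on supp w₀ ending at y span a summand of the
-- bar complex isomorphic to the chain complex of [x, y], bar degree d matching
-- chain length deg w₀ - d.  Quadraticity (generation in degree one) makes every
-- interval [x, y] graded of rank deg y - deg x, so "bar cohomology only in
-- degree 0" and "interval homology only in the top degree" say the same thing.

open import Defs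
open import Level using (Level)
open import Data.Nat using (ℕ; zero; suc; _+_; _∸_; _≤_; _<_; s≤s; z≤n)
import Data.Nat.Properties as ℕ
open import Data.Nat.ListAction using (sum)
open import Data.Bool using (Bool; true; false; not; _∧_; _∨_)
open import Data.Bool.Properties using (not-¬)
open import Data.Vec using ([]; _∷_)
open import Data.Vec.Properties using (∷-injectiveˡ; ∷-injectiveʳ)
open import Data.Fin.Subset using (Subset; ⊥; _∩_; _∪_; _⊆_; ⋃)
open import Data.Fin.Subset.Properties
  using (∩-comm; ∩-distribʳ-∪; ∩-zeroˡ; ∩-zeroʳ; ∪-assoc; ∪-identityˡ; ∪-identityʳ; ⊆-antisym; ⊥⊆; p⊆p∪q; q⊆p∪q)
open import Data.List using (List; []; _∷_; map; length; _++_)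
open import Data.List.Properties using (map-∘; map-++; concatMap-++; ∷-injective)
open import Data.List.Relation.Unary.All as All using (All; []; _∷_)
open import Data.List.Relation.Unary.All.Properties using (++⁺; ++⁻ˡ; ++⁻ʳ; map⁺)
open import Data.List.Relation.Unary.AllPairs using (AllPairs; []; _∷_)
open import Data.List.Relation.Unary.Any using (here; there)
open import Data.List.Membership.Propositional using (_∈_)
open import Data.List.Membership.Propositional.Properties using (∈-map⁺)
open import Data.Product using (Σ; _×_; _,_; proj₁; proj₂)
import Data.Product as Product
open import Data.Product.Properties using (Σ-≡,≡→≡; ,-injectiveʳ-UIP)
open import Data.Sum using (_⊎_; inj₁; inj₂)
open import Data.Unit using (⊤; tt)
open import Data.Empty using (⊥-elim)
open import Function.Bundles using (_⇔_; mk⇔)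
open import Relation.Nullary using (¬_; Dec; yes; no; does)
open import Relation.Nullary.Decidable using (dec-true)
open import Relation.Binary.PropositionalEquality
open import Relation.Binary.Definitions using (DecidableEquality; tri<; tri≈; tri>)
open import Axiom.UniquenessOfIdentityProofs using (UIP; module Decidable⇒UIP)

module Disjointness where

  private variable n : ℕ

  Disjoint : Subset n → Subset n → Set
  Disjoint A B = A ∩ B ≡ ⊥

  disjoint-sym : {A B : Subset n} → Disjoint A B → Disjoint B A
  disjoint-sym {A = A} {B} p = trans (∩-comm B A) p

  ∪-≡⊥ : ∀ (A B : Subset n) → A ∪ B ≡ ⊥ → A ≡ ⊥ × B ≡ ⊥
  ∪-≡⊥ A B eq =
    ⊆-antisym (subst (A ⊆_) eq (p⊆p∪q B)) ⊥⊆ ,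
    ⊆-antisym (subst (B ⊆_) eq (q⊆p∪q A B)) ⊥⊆

  disjoint-∪ˡ⁻ : ∀ (A B C : Subset n) → Disjoint (A ∪ B) C → Disjoint A C × Disjoint B C
  disjoint-∪ˡ⁻ A B C p = ∪-≡⊥ (A ∩ C) (B ∩ C) (trans (sym (∩-distribʳ-∪ C A B)) p)

  disjoint-∪ˡ⁺ : ∀ (A B C : Subset n) → Disjoint A C → Disjoint B C → Disjoint (A ∪ B) C
  disjoint-∪ˡ⁺ A B C p q = trans (∩-distribʳ-∪ C A B) (trans (cong₂ _∪_ p q) (∪-identityˡ ⊥))

  disjoint-∪ʳ⁻ : ∀ (A B C : Subset n) → Disjoint A (B ∪ C) → Disjoint A B × Disjoint A C
  disjoint-∪ʳ⁻ A B C p = Product.map disjoint-sym disjoint-sym (disjoint-∪ˡ⁻ B C A (disjoint-sym p))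

  disjoint-∪ʳ⁺ : ∀ (A B C : Subset n) → Disjoint A B → Disjoint A C → Disjoint A (B ∪ C)
  disjoint-∪ʳ⁺ A B C p q = disjoint-sym (disjoint-∪ˡ⁺ B C A (disjoint-sym p) (disjoint-sym q))

  ∪-cancelˡ : ∀ (A X Y : Subset n) → Disjoint A X → Disjoint A Y → A ∪ X ≡ A ∪ Y → X ≡ Y
  ∪-cancelˡ [] [] [] _ _ _ = refl
  ∪-cancelˡ (a ∷ A) (x ∷ X) (y ∷ Y) p q r =
    cong₂ _∷_ (cancelBit a x y (∷-injectiveˡ p) (∷-injectiveˡ q) (∷-injectiveˡ r))
              (∪-cancelˡ A X Y (∷-injectiveʳ p) (∷-injectiveʳ q) (∷-injectiveʳ r))
    where
    cancelBit : ∀ a x y → a ∧ x ≡ false → a ∧ y ≡ false → a ∨ x ≡ a ∨ y → x ≡ y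
    cancelBit false x     y     _ _ r = r
    cancelBit true  false false _ _ _ = refl
    cancelBit true  true  _     () _ _
    cancelBit true  false true  _ () _

module LinearCombinations {c ℓ : Level} (K : Field c ℓ) where
  open Field K using (Carrier; 0#; _≈_; -_; reflexive; +-cong; +-congˡ; +-identityˡ; +-identityʳ; +-assoc)
    renaming (_+_ to _⊕_; refl to ≈-refl; sym to ≈-sym; trans to ≈-trans)
  open Lin K

  private variable X Y : Set

  mapC : (X → Y) → Comb X → Comb Y
  mapC f = map (λ kt → proj₁ kt , f (proj₂ kt))

  alt-mapC : (f : X → Y) (s : Carrier) (l : List X) → alt s (map f l) ≡ mapC f (alt s l)
  alt-mapC f s []      = refl
  alt-mapC f s (x ∷ l) = cong ((s , f x) ∷_) (alt-mapC f (- s) l)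

  scale-mapC : (f : X → Y) (k : Carrier) (l : Comb X) → scale k (mapC f l) ≡ mapC f (scale k l)
  scale-mapC f k []      = refl
  scale-mapC f k (x ∷ l) = cong (_ ∷_) (scale-mapC f k l)

  lin-mapC : (f : X → Y) (g : Y → Comb Y) (h : X → Comb X) (z : Comb X) →
             All (λ kt → g (f (proj₂ kt)) ≡ mapC f (h (proj₂ kt))) z →
             lin g (mapC f z) ≡ mapC f (lin h z)
  lin-mapC f g h []            []       = refl
  lin-mapC f g h ((k , t) ∷ z) (e ∷ es) =
    trans (cong₂ _++_ (trans (cong (scale k) e) (scale-mapC f k (h t))) (lin-mapC f g h z es))
          (sym (map-++ _ (scale k (h t)) (lin h z)))

  scale-All : {P : X → Set} (k : Carrier) {l : Comb X} →
              All (λ ku → P (proj₂ ku)) l → All (λ ku → P (proj₂ ku)) (scale k l)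
  scale-All k []       = []
  scale-All k (p ∷ ps) = p ∷ scale-All k ps

  alt-All : {P : X → Set} (s : Carrier) (l : List X) → All P l → All (λ kt → P (proj₂ kt)) (alt s l)
  alt-All s []      []       = []
  alt-All s (x ∷ l) (p ∷ ps) = p ∷ alt-All (- s) l ps

  lin-All : {P : Y → Set} (g : X → Comb Y) (z : Comb X) →
            All (λ kt → All (λ ku → P (proj₂ ku)) (g (proj₂ kt))) z →
            All (λ ku → P (proj₂ ku)) (lin g z)
  lin-All g []            []       = []
  lin-All g ((k , t) ∷ z) (a ∷ as) = ++⁺ (scale-All k a) (lin-All g z as)

  module _ {X : Set} (_≟_ : DecidableEquality X) where

    coeff-++ : (u v : Comb X) (s : X) → coeff _≟_ (u ++ v) s ≈ (coeff _≟_ u s ⊕ coeff _≟_ v s)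
    coeff-++ []            v s = ≈-sym (+-identityˡ _)
    coeff-++ ((k , t) ∷ u) v s with does (t ≟ s)
    ... | true  = ≈-trans (+-congˡ (coeff-++ u v s)) (≈-sym (+-assoc _ _ _))
    ... | false = coeff-++ u v s

    coeff-absent : (u : Comb X) (s : X) → All (λ kt → proj₂ kt ≢ s) u → coeff _≟_ u s ≡ 0#
    coeff-absent []            s []       = refl
    coeff-absent ((k , t) ∷ u) s (n ∷ ns) with t ≟ s
    ... | yes e = ⊥-elim (n e)
    ... | no  _ = coeff-absent u s ns

    restrict : (X → Bool) → Comb X → Comb X
    restrict p []            = []
    restrict p ((k , t) ∷ u) with p t
    ... | true  = (k , t) ∷ restrict p u
    ... | false = restrict p u

    coeff-restrict-true : (p : X → Bool) (u : Comb X) (s : X) → p s ≡ true →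
                      coeff _≟_ (restrict p u) s ≡ coeff _≟_ u s
    coeff-restrict-true p []            s ps = refl
    coeff-restrict-true p ((k , t) ∷ u) s ps with p t in pt
    ... | true with t ≟ s
    ...   | yes _ = cong (k ⊕_) (coeff-restrict-true p u s ps)
    ...   | no  _ = coeff-restrict-true p u s ps
    coeff-restrict-true p ((k , t) ∷ u) s ps | false with t ≟ s
    ...   | no  _    = coeff-restrict-true p u s ps
    ...   | yes refl with trans (sym ps) pt
    ...     | ()

    coeff-restrict-false : (p : X → Bool) (u : Comb X) (s : X) → p s ≡ false →
                       coeff _≟_ (restrict p u) s ≡ 0#
    coeff-restrict-false p []            s ps = refl
    coeff-restrict-false p ((k , t) ∷ u) s ps with p t in pt
    ... | false = coeff-restrict-false p u s ps
    ... | true with t ≟ s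
    ...   | no  _    = coeff-restrict-false p u s ps
    ...   | yes refl with trans (sym ps) pt
    ...     | ()

    coeff-restrict-split : (p : X → Bool) (u : Comb X) (s : X) →
      (coeff _≟_ (restrict p u) s ⊕ coeff _≟_ (restrict (λ t → not (p t)) u) s) ≈ coeff _≟_ u s
    coeff-restrict-split p u s with p s in ps
    ... | true  = ≈-trans (+-cong (reflexive (coeff-restrict-true p u s ps))
                                  (reflexive (coeff-restrict-false _ u s (cong not ps)))) (+-identityʳ _)
    ... | false = ≈-trans (+-cong (reflexive (coeff-restrict-false p u s ps))
                                  (reflexive (coeff-restrict-true _ u s (cong not ps)))) (+-identityˡ _)

    restrict-All : (p : X → Bool) {P : Carrier × X → Set} (u : Comb X) → All P u →
               All (λ kt → P kt × p (proj₂ kt) ≡ true) (restrict p u)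
    restrict-All p []            []       = []
    restrict-All p ((k , t) ∷ u) (q ∷ qs) with p t in pt
    ... | true  = (q , pt) ∷ restrict-All p u qs
    ... | false = restrict-All p u qs

    restrict-++ : (p : X → Bool) (u v : Comb X) → restrict p (u ++ v) ≡ restrict p u ++ restrict p v
    restrict-++ p []            v = refl
    restrict-++ p ((k , t) ∷ u) v with p t
    ... | true  = cong (_ ∷_) (restrict-++ p u v)
    ... | false = restrict-++ p u v

    restrict-all : (p : X → Bool) (u : Comb X) → All (λ kt → p (proj₂ kt) ≡ true) u → restrict p u ≡ u
    restrict-all p []            []       = refl
    restrict-all p ((k , t) ∷ u) (e ∷ es) rewrite e = cong (_ ∷_) (restrict-all p u es)

    restrict-none : (p : X → Bool) (u : Comb X) → All (λ kt → p (proj₂ kt) ≡ false) u → restrict p u ≡ []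
    restrict-none p []            []       = refl
    restrict-none p ((k , t) ∷ u) (e ∷ es) rewrite e = restrict-none p u es

    restrict-Eq : (p : X → Bool) (u v : Comb X) → Eqᶜ _≟_ u v → Eqᶜ _≟_ (restrict p u) (restrict p v)
    restrict-Eq p u v e s with p s in ps
    ... | true  = ≈-trans (reflexive (coeff-restrict-true p u s ps))
                          (≈-trans (e s) (reflexive (sym (coeff-restrict-true p v s ps))))
    ... | false = reflexive (trans (coeff-restrict-false p u s ps) (sym (coeff-restrict-false p v s ps)))

    Preserves : (X → Comb X) → (X → Bool) → Comb X → Set c
    Preserves d p z = All (λ kt → All (λ ku → p (proj₂ ku) ≡ p (proj₂ kt)) (d (proj₂ kt))) z

    Preserves-not : (d : X → Comb X) (p : X → Bool) (z : Comb X) →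
                    Preserves d p z → Preserves d (λ t → not (p t)) z
    Preserves-not d p z = All.map (All.map (cong not))

    lin-restrict : (p : X → Bool) (d : X → Comb X) (z : Comb X) → Preserves d p z →
               lin d (restrict p z) ≡ restrict p (lin d z)
    lin-restrict p d []            []       = refl
    lin-restrict p d ((k , t) ∷ z) (a ∷ as) with p t in pt
    ... | true  = sym (trans (restrict-++ p (scale k (d t)) (lin d z))
                             (cong₂ _++_ (restrict-all p _ (scale-All k a)) (sym (lin-restrict p d z as))))
    ... | false = sym (trans (restrict-++ p (scale k (d t)) (lin d z))
                             (cong₂ _++_ (restrict-none p _ (scale-All k a)) (sym (lin-restrict p d z as))))

    restrict-boundary : (p : X → Bool) (d : X → Comb X) (b z : Comb X) → Preserves d p b →
                        All (λ kt → p (proj₂ kt) ≡ true) z →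
                        Eqᶜ _≟_ (lin d b) z → Eqᶜ _≟_ (lin d (restrict p b)) z
    restrict-boundary p d b z pres zp e s =
      ≈-trans (reflexive (cong (λ w → coeff _≟_ w s) (lin-restrict p d b pres)))
        (≈-trans (restrict-Eq p (lin d b) z e s) (reflexive (cong (λ w → coeff _≟_ w s) (restrict-all p z zp))))

    boundary-of-split : (p : X → Bool) (d : X → Comb X) (b₁ b₂ z : Comb X) →
                        Eqᶜ _≟_ (lin d b₁) (restrict p z) → Eqᶜ _≟_ (lin d b₂) (restrict (λ t → not (p t)) z) →
                        Eqᶜ _≟_ (lin d (b₁ ++ b₂)) z
    boundary-of-split p d b₁ b₂ z eq₁ eq₂ s =
      ≈-trans (reflexive (cong (λ w → coeff _≟_ w s) (concatMap-++ _ b₁ b₂)))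
        (≈-trans (coeff-++ (lin d b₁) (lin d b₂) s)
          (≈-trans (+-cong (eq₁ s) (eq₂ s)) (coeff-restrict-split p z s)))

  module InjectiveRelabelling {X Y : Set} (_≟x_ : DecidableEquality X) (_≟y_ : DecidableEquality Y)
           (f : X → Y) (R : X → Set) (inj : ∀ t s → R t → R s → f t ≡ f s → t ≡ s) where

    coeff-mapC : (u : Comb X) (s : X) → All (λ kt → R (proj₂ kt)) u → R s →
                 coeff _≟y_ (mapC f u) (f s) ≡ coeff _≟x_ u s
    coeff-mapC []            s []       rs = refl
    coeff-mapC ((k , t) ∷ u) s (r ∷ ru) rs with t ≟x s
    ... | yes refl with f t ≟y f t
    ...   | yes _ = cong (k ⊕_) (coeff-mapC u s ru rs)
    ...   | no ne = ⊥-elim (ne refl)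
    coeff-mapC ((k , t) ∷ u) s (r ∷ ru) rs | no ne with f t ≟y f s
    ...   | yes e = ⊥-elim (ne (inj t s r rs e))
    ...   | no  _ = coeff-mapC u s ru rs

    locate : (P : X → Set) → (∀ t → Dec (P t)) → (u : Comb X) → All (λ kt → R (proj₂ kt)) u →
             (Σ X λ t → R t × P t) ⊎ All (λ kt → ¬ P (proj₂ kt)) u
    locate P P? []            []       = inj₂ []
    locate P P? ((k , t) ∷ u) (r ∷ ru) with P? t | locate P P? u ru
    ... | yes pt | _          = inj₁ (t , r , pt)
    ... | no ¬pt | inj₁ found = inj₁ found
    ... | no ¬pt | inj₂ none  = inj₂ (¬pt ∷ none)

    mapC-respects : (u v : Comb X) → All (λ kt → R (proj₂ kt)) u → All (λ kt → R (proj₂ kt)) v →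
                    Eqᶜ _≟x_ u v → Eqᶜ _≟y_ (mapC f u) (mapC f v)
    mapC-respects u v ru rv e c with locate (λ t → f t ≡ c) (λ t → f t ≟y c) (u ++ v) (++⁺ ru rv)
    ... | inj₁ (t , r , refl) = ≈-trans (reflexive (coeff-mapC u t ru r))
                                  (≈-trans (e t) (reflexive (sym (coeff-mapC v t rv r))))
    ... | inj₂ none = reflexive (trans (coeff-absent _≟y_ (mapC f u) c (map⁺ (++⁻ˡ u none)))
                                       (sym (coeff-absent _≟y_ (mapC f v) c (map⁺ (++⁻ʳ u none)))))

    mapC-reflects : (u v : Comb X) → All (λ kt → R (proj₂ kt)) u → All (λ kt → R (proj₂ kt)) v →
                    Eqᶜ _≟y_ (mapC f u) (mapC f v) → Eqᶜ _≟x_ u v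
    mapC-reflects u v ru rv e s with locate (λ t → t ≡ s) (λ t → t ≟x s) (u ++ v) (++⁺ ru rv)
    ... | inj₁ (t , r , refl) = ≈-trans (reflexive (sym (coeff-mapC u t ru r)))
                                  (≈-trans (e (f t)) (reflexive (coeff-mapC v t rv r)))
    ... | inj₂ none = reflexive (trans (coeff-absent _≟x_ u s (++⁻ˡ u none))
                                       (sym (coeff-absent _≟x_ v s (++⁻ʳ u none))))

module PointMonoid (M : CMonoid) where
  open CMonoid M
  open CM M
  open Disjointness

  private variable n : ℕ

  Disj : Pt n → Pt n → Set
  Disj x w = Disjoint (proj₁ x) (proj₁ w)

  private
    subset-UIP : UIP (Subset n)
    subset-UIP = Decidable⇒UIP.≡-irrelevant _≟ˢ_

    Σ-subst : {X Y : Subset n} (q : X ≡ Y) (v : Car X) → _≡_ {A = Pt n} (X , v) (Y , subst Car q v)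
    Σ-subst q v = Σ-≡,≡→≡ (q , refl)

  mul-disj : {A B : Subset n} {a : Car A} {b : Car B} (p : Disjoint A B) →
             mul (A , a) (B , b) ≡ (A ∪ B , ν A B p a b)
  mul-disj {A = A} {B} {a} {b} p with (A ∩ B) ≟ˢ ⊥
  ... | yes p' = cong (λ r → (A ∪ B , ν A B r a b)) (subset-UIP p' p)
  ... | no ¬p  = ⊥-elim (¬p p)

  supp-mul : (x w : Pt n) → Disj x w → proj₁ (mul x w) ≡ proj₁ x ∪ proj₁ w
  supp-mul x w p = cong proj₁ (mul-disj p)

  mul-identityʳ : (x : Pt n) → mul x 0̂ ≡ x
  mul-identityʳ (A , a) = trans (mul-disj (∩-zeroʳ A))
    (trans (Σ-subst (∪-identityʳ A) _) (cong (A ,_) (unitʳ A (∩-zeroʳ A) (∪-identityʳ A) a)))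

  mul-identityˡ : (x : Pt n) → mul 0̂ x ≡ x
  mul-identityˡ (A , a) = trans (mul-disj (∩-zeroˡ A))
    (trans (Σ-subst (∪-identityˡ A) _) (cong (A ,_) (unitˡ A (∩-zeroˡ A) (∪-identityˡ A) a)))

  mul-assoc : (x w v : Pt n) → Disj x w → Disj x v → Disj w v → mul (mul x w) v ≡ mul x (mul w v)
  mul-assoc (A , a) (B , b) (C , c) pAB pAC pBC = begin
    mul (mul (A , a) (B , b)) (C , c)          ≡⟨ cong (λ z → mul z (C , c)) (mul-disj pAB) ⟩
    mul (A ∪ B , ν A B pAB a b) (C , c)        ≡⟨ mul-disj pAB-C ⟩
    ((A ∪ B) ∪ C , ν (A ∪ B) C pAB-C (ν A B pAB a b) c)
                                               ≡⟨ Σ-subst (∪-assoc A B C) _ ⟩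
    (A ∪ (B ∪ C) , _)                          ≡⟨ cong (A ∪ (B ∪ C) ,_) (assoc A B C pAB pAB-C pBC pA-BC (∪-assoc A B C) a b c) ⟩
    (A ∪ (B ∪ C) , ν A (B ∪ C) pA-BC a (ν B C pBC b c))
                                               ≡⟨ sym (mul-disj pA-BC) ⟩
    mul (A , a) (B ∪ C , ν B C pBC b c)        ≡⟨ cong (mul (A , a)) (sym (mul-disj pBC)) ⟩
    mul (A , a) (mul (B , b) (C , c))          ∎
    where
    open ≡-Reasoning
    pAB-C : Disjoint (A ∪ B) C
    pAB-C = disjoint-∪ˡ⁺ A B C pAC pBC
    pA-BC : Disjoint A (B ∪ C)
    pA-BC = disjoint-∪ʳ⁺ A B C pAB pAC

  mul-cancelˡ : (x w v : Pt n) → Disj x w → Disj x v → mul x w ≡ mul x v → w ≡ v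
  mul-cancelˡ (A , a) (B , b) (C , c) p p' eq = cancel (∪-cancelˡ A B C p p' (cong proj₁ eq')) p' eq'
    where
    eq' : _≡_ {A = Pt _} (A ∪ B , ν A B p a b) (A ∪ C , ν A C p' a c)
    eq' = trans (sym (mul-disj p)) (trans eq (mul-disj p'))
    cancel : {C : Subset _} {c : Car C} (B≡C : B ≡ C) (p' : Disjoint A C) →
             _≡_ {A = Pt _} (A ∪ B , ν A B p a b) (A ∪ C , ν A C p' a c) → _≡_ {A = Pt _} (B , b) (C , c)
    cancel refl p' e with subset-UIP p p'
    ... | refl = cong (B ,_) (cancelˡ A B p a b _ (,-injectiveʳ-UIP subset-UIP e))

  ≤ν⇒factor : (x y : Pt n) → x ≤ν y → Σ (Pt n) λ w → Disj x w × mul x w ≡ y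
  ≤ν⇒factor (A , a) (B , b) (C , p , q , m' , eq) =
    (C , m') , p , trans (mul-disj p) (trans (Σ-subst q _) (cong (B ,_) eq))

  factor⇒≤ν : (x w : Pt n) → Disj x w → x ≤ν mul x w
  factor⇒≤ν (A , a) (C , m') p = subst ((A , a) ≤ν_) (sym (mul-disj p)) (C , p , refl , m' , refl)

  ≤ν-refl : (x : Pt n) → x ≤ν x
  ≤ν-refl x = subst (x ≤ν_) (mul-identityʳ x) (factor⇒≤ν x 0̂ (∩-zeroʳ (proj₁ x)))

  0̂-least : (x : Pt n) → 0̂ ≤ν x
  0̂-least x = subst (0̂ ≤ν_) (mul-identityˡ x) (factor⇒≤ν 0̂ x (∩-zeroˡ (proj₁ x)))

-- It visits x·w₁, x·w₁w₂, …, ends at x·w₁⋯w_r, and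
-- determines the chain  chainOf x t = x, x·w₁, x·w₁w₂, …  of M.  (The field K
-- only enters through the list operations of the differentials, defined in Lin K.)
module Walks {c ℓ : Level} (K : Field c ℓ) (M : CMonoid) where
  open CMonoid M
  open CM M
  open Disjointness
  open PointMonoid M
  open Lin K using (merges; delButLast; interiorFaces)

  private variable n : ℕ

  Admissible : Pt n → List (Pt n) → Set
  Admissible x []       = ⊤
  Admissible x (w ∷ ws) = Disj x w × Admissible (mul x w) ws

  visits : Pt n → List (Pt n) → List (Pt n)
  visits x []       = []
  visits x (w ∷ ws) = mul x w ∷ visits (mul x w) ws

  chainOf : Pt n → List (Pt n) → List (Pt n)
  chainOf x t = x ∷ visits x t

  endpoint : Pt n → List (Pt n) → Pt n
  endpoint x []       = x
  endpoint x (w ∷ ws) = endpoint (mul x w) ws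

  support : List (Pt n) → Subset n
  support t = ⋃ (map proj₁ t)

  PairwiseDisjoint : List (Pt n) → Set
  PairwiseDisjoint t = AllPairs (λ a b → proj₁ a ∩ proj₁ b ≡ ⊥) t

  length-visits : (x : Pt n) (t : List (Pt n)) → length (visits x t) ≡ length t
  length-visits x []       = refl
  length-visits x (w ∷ ws) = cong suc (length-visits (mul x w) ws)

  disjoint-support⁻ : (X : Subset n) (t : List (Pt n)) → Disjoint X (support t) → All (λ b → Disjoint X (proj₁ b)) t
  disjoint-support⁻ X []       _ = []
  disjoint-support⁻ X (w ∷ ws) p = proj₁ (disjoint-∪ʳ⁻ X _ _ p) ∷ disjoint-support⁻ X ws (proj₂ (disjoint-∪ʳ⁻ X _ _ p))

  disjoint-support⁺ : (X : Subset n) (t : List (Pt n)) → All (λ b → Disjoint X (proj₁ b)) t → Disjoint X (support t)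
  disjoint-support⁺ X []       []       = ∩-zeroʳ X
  disjoint-support⁺ X (w ∷ ws) (p ∷ ps) = disjoint-∪ʳ⁺ X _ _ p (disjoint-support⁺ X ws ps)

  admissible⇒ : (x : Pt n) (t : List (Pt n)) → Admissible x t →
                PairwiseDisjoint t × Disjoint (proj₁ x) (support t)
  admissible⇒ x []       _       = [] , ∩-zeroʳ _
  admissible⇒ x (w ∷ ws) (d , a) with admissible⇒ (mul x w) ws a
  ... | pw , p with disjoint-∪ˡ⁻ (proj₁ x) (proj₁ w) (support ws) (subst (λ Z → Disjoint Z (support ws)) (supp-mul x w d) p)
  ...   | px , pw' = (disjoint-support⁻ (proj₁ w) ws pw' ∷ pw) , disjoint-∪ʳ⁺ (proj₁ x) _ _ d px

  ⇒admissible : (x : Pt n) (t : List (Pt n)) → PairwiseDisjoint t → Disjoint (proj₁ x) (support t) →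
                Admissible x t
  ⇒admissible x []       _        _ = tt
  ⇒admissible x (w ∷ ws) (a ∷ pw) p with disjoint-∪ʳ⁻ (proj₁ x) _ _ p
  ... | pxw , pxs = pxw , ⇒admissible (mul x w) ws pw
        (subst (λ Z → Disjoint Z (support ws)) (sym (supp-mul x w pxw))
               (disjoint-∪ˡ⁺ _ _ _ pxs (disjoint-support⁺ _ ws a)))

  endpoint-support : (x : Pt n) (t : List (Pt n)) → Admissible x t →
                     proj₁ (endpoint x t) ≡ proj₁ x ∪ support t
  endpoint-support x []       _       = sym (∪-identityʳ _)
  endpoint-support x (w ∷ ws) (d , a) =
    trans (endpoint-support (mul x w) ws a) (trans (cong (_∪ support ws) (supp-mul x w d)) (∪-assoc _ _ _))

  support-prod : (t : List (Pt n)) → PairwiseDisjoint t → proj₁ (prod t) ≡ support t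
  support-prod []       _        = refl
  support-prod (w ∷ ws) (a ∷ pw) =
    trans (supp-mul w (prod ws) w-prod) (cong (proj₁ w ∪_) (support-prod ws pw))
    where
    w-prod : Disj w (prod ws)
    w-prod = subst (Disjoint (proj₁ w)) (sym (support-prod ws pw)) (disjoint-support⁺ _ ws a)

  disjoint-prod : (X : Subset n) (t : List (Pt n)) → PairwiseDisjoint t → Disjoint X (support t) →
                  Disjoint X (proj₁ (prod t))
  disjoint-prod X t pw p = subst (Disjoint X) (sym (support-prod t pw)) p

  endpoint-prod : (x : Pt n) (t : List (Pt n)) → Admissible x t → endpoint x t ≡ mul x (prod t)
  endpoint-prod x []       _       = sym (mul-identityʳ x)
  endpoint-prod x (w ∷ ws) (d , a) with admissible⇒ x (w ∷ ws) (d , a)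
  ... | (aw ∷ pw) , p =
    trans (endpoint-prod (mul x w) ws a)
      (mul-assoc x w (prod ws) d (disjoint-prod _ ws pw (proj₂ (disjoint-∪ʳ⁻ _ _ _ p)))
                                 (disjoint-prod _ ws pw (disjoint-support⁺ _ ws aw)))

  merge-step : (x w₁ w₂ : Pt n) → Disj x w₁ → Disj (mul x w₁) w₂ →
               Disj x (mul w₁ w₂) × Disj w₁ w₂ × mul x (mul w₁ w₂) ≡ mul (mul x w₁) w₂
  merge-step x w₁ w₂ d₁ d₂
    with disjoint-∪ˡ⁻ (proj₁ x) (proj₁ w₁) (proj₁ w₂) (subst (λ Z → Disjoint Z (proj₁ w₂)) (supp-mul x w₁ d₁) d₂)
  ... | pxw₂ , p₁₂ =
    subst (Disjoint (proj₁ x)) (sym (supp-mul w₁ w₂ p₁₂)) (disjoint-∪ʳ⁺ _ _ _ d₁ pxw₂) ,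
    p₁₂ , sym (mul-assoc x w₁ w₂ d₁ pxw₂ p₁₂)

  -- Merging w_i, w_{i+1} deletes the i-th visited point: the interior faces of
  -- chainOf x t are the chains of the merged walks, in the same order.
  delButLast-visits : (x : Pt n) (t : List (Pt n)) → Admissible x t →
                      delButLast (visits x t) ≡ map (visits x) (merges mul t)
  delButLast-visits x []             _              = refl
  delButLast-visits x (w ∷ [])       _              = refl
  delButLast-visits x (w₁ ∷ w₂ ∷ ws) (d₁ , d₂ , a) =
    cong₂ _∷_ (cong (λ z → z ∷ visits z ws) (sym (proj₂ (proj₂ (merge-step x w₁ w₂ d₁ d₂)))))
              (trans (cong (map (mul x w₁ ∷_)) (delButLast-visits (mul x w₁) (w₂ ∷ ws) (d₂ , a)))
                     (trans (sym (map-∘ (merges mul (w₂ ∷ ws)))) (map-∘ (merges mul (w₂ ∷ ws)))))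

  interiorFaces-chainOf : (x : Pt n) (t : List (Pt n)) → Admissible x t →
                          interiorFaces (chainOf x t) ≡ map (chainOf x) (merges mul t)
  interiorFaces-chainOf x t a =
    trans (cong (map (x ∷_)) (delButLast-visits x t a)) (sym (map-∘ (merges mul t)))

  merges-admissible : (x : Pt n) (t : List (Pt n)) → Admissible x t →
                      All (λ s → Admissible x s × endpoint x s ≡ endpoint x t) (merges mul t)
  merges-admissible x []             _             = []
  merges-admissible x (w ∷ [])       _             = []
  merges-admissible x (w₁ ∷ w₂ ∷ ws) (d₁ , d₂ , a) =
    ((d , subst (λ z → Admissible z ws) (sym assoc′) a) , cong (λ z → endpoint z ws) assoc′)
    ∷ map⁺ (All.map (λ { (a′ , e′) → (d₁ , a′) , e′ }) (merges-admissible (mul x w₁) (w₂ ∷ ws) (d₂ , a)))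
    where
    d : Disj x (mul w₁ w₂)
    d = proj₁ (merge-step x w₁ w₂ d₁ d₂)
    assoc′ : mul x (mul w₁ w₂) ≡ mul (mul x w₁) w₂
    assoc′ = proj₂ (proj₂ (merge-step x w₁ w₂ d₁ d₂))

  -- By left cancellation a walk is determined by its chain.
  chainOf-injective : (x : Pt n) (t s : List (Pt n)) → Admissible x t → Admissible x s →
                      chainOf x t ≡ chainOf x s → t ≡ s
  chainOf-injective x []       []       _       _        _  = refl
  chainOf-injective x (w ∷ ws) (v ∷ vs) (d , a) (d′ , b) eq
    with mul-cancelˡ x w v d d′ (proj₁ (∷-injective (proj₂ (∷-injective eq))))
  ... | refl = cong (w ∷_) (chainOf-injective (mul x w) ws vs a b (proj₂ (∷-injective eq)))

module GradedWalks {c ℓ : Level} (K : Field c ℓ) (M : CMonoid) (G : Quad.Grading K M)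
    (unit-of-degree-zero : ∀ {n} (w : CM.Pt M n) → Quad.Grading.degP G w ≡ 0 → w ≡ CM.0̂ M) where
  open CMonoid M
  open CM M
  open Quad.Grading G
  open Lin K
  open MoebiusCM K M
  open LinearCombinations K using (mapC)
  open PointMonoid M
  open Walks K M

  private variable n : ℕ

  Positive : Pt n → Set
  Positive w = 1 ≤ degP w

  deg-mul : (x w : Pt n) → Disj x w → degP (mul x w) ≡ degP x + degP w
  deg-mul (A , a) (B , b) p = trans (cong degP (mul-disj p)) (deg-ν A B p a b)

  deg-prod : (t : List (Pt n)) → PairwiseDisjoint t → degP (prod t) ≡ sum (map degP t)
  deg-prod []       _        = deg-e
  deg-prod (w ∷ ws) (a ∷ pw) =
    trans (deg-mul w (prod ws) (disjoint-prod _ ws pw (disjoint-support⁺ _ ws a))) (cong (degP w +_) (deg-prod ws pw))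

  endpoint-deg : (x : Pt n) (t : List (Pt n)) → Admissible x t → degP (endpoint x t) ≡ degP x + sum (map degP t)
  endpoint-deg x []       _       = sym (ℕ.+-identityʳ _)
  endpoint-deg x (w ∷ ws) (d , a) =
    trans (endpoint-deg (mul x w) ws a) (trans (cong (_+ sum (map degP ws)) (deg-mul x w d)) (ℕ.+-assoc (degP x) (degP w) _))

  length≤sum : (t : List (Pt n)) → All Positive t → length t ≤ sum (map degP t)
  length≤sum []       []       = z≤n
  length≤sum (w ∷ ws) (p ∷ ps) = ℕ.+-mono-≤ p (length≤sum ws ps)

  -- Multiplying by a positive-degree element is a strict step up; conversely a
  -- strict step x < x·w forces w ≠ e, hence deg w > 0.
  mul-raises-deg : (x w : Pt n) → Disj x w → Positive w → degP x < degP (mul x w)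
  mul-raises-deg x w d p =
    ℕ.≤-trans (ℕ.≤-trans (ℕ.≤-reflexive (ℕ.+-comm 1 (degP x))) (ℕ.+-monoʳ-≤ (degP x) p))
              (ℕ.≤-reflexive (sym (deg-mul x w d)))

  strict-step : (x w : Pt n) → Disj x w → Positive w → x <ν mul x w
  strict-step x w d p = factor⇒≤ν x w d , λ x≡xw → ℕ.<⇒≢ (mul-raises-deg x w d p) (cong degP x≡xw)

  step-positive : (x w : Pt n) → Disj x w → x ≢ mul x w → Positive w
  step-positive x w d x≢xw with degP w in deg-w
  ... | zero  = ⊥-elim (x≢xw (sym (trans (cong (mul x) (unit-of-degree-zero w deg-w)) (mul-identityʳ x))))
  ... | suc _ = s≤s z≤n

  <ν-deg : (a b : Pt n) → a <ν b → suc (degP a) ≤ degP b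
  <ν-deg a b (a≤b , a≢b) with ≤ν⇒factor a b a≤b
  ... | w , d , refl = mul-raises-deg a w d (step-positive a w d a≢b)

  degree-one-covers : (x w : Pt n) → Disj x w → degP w ≡ 1 → x ⋖ mul x w
  degree-one-covers x w d deg-w = strict-step x w d (ℕ.≤-reflexive (sym deg-w)) , λ z (x<z , z<xw) →
    ℕ.1+n≰n (ℕ.≤-trans (ℕ.≤-trans (s≤s (<ν-deg x z x<z)) (<ν-deg z (mul x w) z<xw))
      (ℕ.≤-reflexive (trans (deg-mul x w d) (trans (cong (degP x +_) deg-w) (ℕ.+-comm (degP x) 1)))))

  walkOfPath : (x y : Pt n) (zs : List (Pt n)) → StrictPath x y zs →
               Σ (List (Pt n)) λ t → Admissible x t × All Positive t × visits x t ≡ zs × endpoint x t ≡ y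
  walkOfPath x y []       x≡y = [] , tt , [] , refl , x≡y
  walkOfPath x y (z ∷ zs) ((x≤z , x≢z) , path) with ≤ν⇒factor x z x≤z
  ... | w , d , refl with walkOfPath (mul x w) y zs path
  ...   | t , a , ps , vis , end = (w ∷ t) , (d , a) , (step-positive x w d x≢z ∷ ps) , cong (mul x w ∷_) vis , end

  pathOfWalk : (x : Pt n) (t : List (Pt n)) → Admissible x t → All Positive t →
               StrictPath x (endpoint x t) (visits x t)
  pathOfWalk x []       _       _        = refl
  pathOfWalk x (w ∷ ws) (d , a) (p ∷ ps) = strict-step x w d p , pathOfWalk (mul x w) ws a ps

  -- t is an admissible positive walk of r steps from x to y; these index the
  -- chains of length r of the interval [x, y].
  WalkIn : Pt n → Pt n → ℕ → List (Pt n) → Set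
  WalkIn x y r t = Admissible x t × All Positive t × length t ≡ r × endpoint x t ≡ y

  walk⇒chain : (x y : Pt n) (r : ℕ) (t : List (Pt n)) → WalkIn x y r t → ChainIn x y r (chainOf x t)
  walk⇒chain x y r t (a , ps , len , end) =
    refl , trans (length-visits x t) len , subst (λ q → StrictPath x q (visits x t)) end (pathOfWalk x t a ps)

  walks⇒chains : (x y : Pt n) (r : ℕ) (z : Comb (List (Pt n))) → All (λ kt → WalkIn x y r (proj₂ kt)) z →
                 All (λ kt → ChainIn x y r (proj₂ kt)) (mapC (chainOf x) z)
  walks⇒chains x y r []            []       = []
  walks⇒chains x y r ((k , t) ∷ z) (g ∷ gs) = walk⇒chain x y r t g ∷ walks⇒chains x y r z gs

  chains⇒walks : (x y : Pt n) (r : ℕ) (z : Comb (List (Pt n))) → All (λ kt → ChainIn x y r (proj₂ kt)) z →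
                 Σ (Comb (List (Pt n))) λ z′ → All (λ kt → WalkIn x y r (proj₂ kt)) z′ × mapC (chainOf x) z′ ≡ z
  chains⇒walks x y r []                    []                         = [] , [] , refl
  chains⇒walks x y r ((k , [])     ∷ z)    (()                  ∷ _)
  chains⇒walks x y r ((k , (_ ∷ zs)) ∷ z)  ((refl , len , path) ∷ cs)
    with walkOfPath x y zs path | chains⇒walks x y r z cs
  ... | t , a , ps , vis , end | z′ , ws , refl =
    ((k , t) ∷ z′) , ((a , ps , trans (sym (length-visits x t)) (trans (cong length vis) len) , end) ∷ ws) ,
    cong (λ q → (k , x ∷ q) ∷ mapC (chainOf x) z′) vis

-- Since M is generated in degree one, only
-- e has degree zero and every element of degree ≥ 2 splits off a degree-one
-- factor; hence covers raise the degree by exactly one, every interval [x, y]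
-- is graded of rank deg y - deg x, and [0̂, y] has a maximal chain of length deg y.
module QuadraticIntervals {c ℓ : Level} (K : Field c ℓ) (M : CMonoid) (Q : Quad.Quadratic K M) where
  open CMonoid M
  open CM M
  open Quad K M
  open Quadratic Q
  open MoebiusCM K M
  open Disjointness
  open PointMonoid M
  open Walks K M

  private variable n : ℕ

  degree-zero-is-unit : (w : Pt n) → degP w ≡ 0 → w ≡ 0̂
  degree-zero-is-unit (C , m) deg-m with generated C m
  ... | []    , _                  , prod≡ = sym prod≡
  ... | _ ∷ _ , (_ , length≡ , _) , _ with trans length≡ deg-m
  ...   | ()

  open GradedWalks K M grading degree-zero-is-unit public

  split-generator : (w : Pt n) → 2 ≤ degP w →
                    Σ (Pt n) λ u → Σ (Pt n) λ v → degP u ≡ 1 × Positive v × Disj u v × mul u v ≡ w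
  split-generator (C , m) two≤ with generated C m
  ... | [] , (_ , length≡ , _) , _ with subst (2 ≤_) (sym length≡) two≤
  ...   | ()
  split-generator (C , m) two≤ | _ ∷ [] , (_ , length≡ , _) , _ with subst (2 ≤_) (sym length≡) two≤
  ...   | s≤s ()
  split-generator (C , m) two≤ | u ∷ v₁ ∷ vs , ((u-vs ∷ pw , _) , _ , deg-u ∷ deg-v₁ ∷ _) , prod≡ =
    u , prod (v₁ ∷ vs) , deg-u , positive , disjoint-prod _ (v₁ ∷ vs) pw (disjoint-support⁺ _ (v₁ ∷ vs) u-vs) , prod≡
    where
    positive : Positive (prod (v₁ ∷ vs))
    positive = ℕ.≤-trans (ℕ.≤-trans (ℕ.≤-reflexive (sym deg-v₁)) (ℕ.m≤m+n (degP v₁) _))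
                         (ℕ.≤-reflexive (sym (deg-prod (v₁ ∷ vs) pw)))

  -- A cover x ⋖ x·w has deg w = 1: otherwise x < x·u < x·w for w = u·v as above.
  cover-deg : (x z : Pt n) → x ⋖ z → degP z ≡ suc (degP x)
  cover-deg x z ((x≤z , x≢z) , nothing-between) with ≤ν⇒factor x z x≤z
  ... | w , d , refl with degP w in deg-w | step-positive x w d x≢z
  ...   | suc zero    | _ = trans (deg-mul x w d) (trans (cong (degP x +_) deg-w) (ℕ.+-comm (degP x) 1))
  ...   | suc (suc j) | _ with split-generator w (subst (2 ≤_) (sym deg-w) (s≤s (s≤s z≤n)))
  ...     | u , v , deg-u , pos-v , d-uv , refl = ⊥-elim (nothing-between (mul x u) (x<xu , xu<xw))
    where
    x-uv : Disjoint (proj₁ x) (proj₁ u ∪ proj₁ v)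
    x-uv = subst (Disjoint (proj₁ x)) (supp-mul u v d-uv) d
    d-xu : Disj x u
    d-xu = proj₁ (disjoint-∪ʳ⁻ _ _ _ x-uv)
    d-xu-v : Disj (mul x u) v
    d-xu-v = subst (λ Z → Disjoint Z (proj₁ v)) (sym (supp-mul x u d-xu))
                   (disjoint-∪ˡ⁺ _ _ _ (proj₂ (disjoint-∪ʳ⁻ _ _ _ x-uv)) d-uv)
    x<xu : x <ν mul x u
    x<xu = strict-step x u d-xu (ℕ.≤-reflexive (sym deg-u))
    xu<xw : mul x u <ν mul x (mul u v)
    xu<xw = subst (mul x u <ν_) (mul-assoc x u v d-xu (proj₂ (disjoint-∪ʳ⁻ _ _ _ x-uv)) d-uv)
                  (strict-step (mul x u) v d-xu-v pos-v)

  saturated-length : (x y : Pt n) (zs : List (Pt n)) → SatPath x zs → StrictPath x y zs →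
                     degP y ≡ degP x + length zs
  saturated-length x y []       _            refl       = sym (ℕ.+-identityʳ _)
  saturated-length x y (z ∷ zs) (x⋖z , sat) (_ , path) =
    trans (saturated-length z y zs sat path)
          (trans (cong (_+ length zs) (cover-deg x z x⋖z)) (sym (ℕ.+-suc (degP x) (length zs))))

  interval-graded : (x y : Pt n) → GradedOfRank x y (degP y ∸ degP x)
  interval-graded x y l []       (() , _)
  interval-graded x y l (_ ∷ zs) ((refl , length≡ , path) , sat) =
    trans (sym length≡) (sym (trans (cong (_∸ degP x) (saturated-length x y zs sat path)) (ℕ.m+n∸m≡n (degP x) (length zs))))

  saturated-visits : (x : Pt n) (t : List (Pt n)) → Admissible x t → All Deg1 t → SatPath x (visits x t)
  saturated-visits x []       _       _              = tt
  saturated-visits x (w ∷ ws) (d , a) (deg-w ∷ degs) = degree-one-covers x w d deg-w , saturated-visits (mul x w) ws a degs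

  -- Writing y as a product of degree-one elements gives a maximal chain of [0̂, y].
  maximal-chain : (y : Pt n) → Σ (List (Pt n)) λ ch → MaxChainIn 0̂ y (degP y) ch
  maximal-chain (U , m) with generated U m
  ... | t , ((pw , _) , length≡ , degs) , prod≡ =
    chainOf 0̂ t ,
    (refl , trans (length-visits 0̂ t) length≡ ,
      subst (λ y → StrictPath 0̂ y (visits 0̂ t)) ends (pathOfWalk 0̂ t a (All.map (λ deg-w → ℕ.≤-reflexive (sym deg-w)) degs))) ,
    saturated-visits 0̂ t a degs
    where
    a : Admissible 0̂ t
    a = ⇒admissible 0̂ t pw (∩-zeroˡ _)
    ends : endpoint 0̂ t ≡ (U , m)
    ends = trans (endpoint-prod 0̂ t a) (trans (mul-identityˡ (prod t)) prod≡)

-- The comparison between the bar complex and the chain complexes of intervals.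
-- chainOf x is an injective chain map on admissible walks from x, and the bar
-- differential does not move endpoints, so Bar restricted to walks from x that
-- end at y is the chain complex of [x, y].  For y = x·w₀ these walks are
-- exactly bar basis elements on supp w₀, with bar degree + length = deg w₀.
module BarVersusChains {c ℓ : Level} (K : Field c ℓ) (M : CMonoid) (Q : Quad.Quadratic K M) where
  open Field K using (1#)
  open CMonoid M
  open CM M
  open Quad K M
  open Quadratic Q
  open Lin K
  open MoebiusCM K M
  open LinearCombinations K
  open Disjointness
  open PointMonoid M
  open Walks K M
  open QuadraticIntervals K M Q

  private variable n : ℕ

  ∂-chainOf : (x : Pt n) (z : Comb (List (Pt n))) → All (λ kt → Admissible x (proj₂ kt)) z →
              lin ∂ (mapC (chainOf x) z) ≡ mapC (chainOf x) (lin (barDiff Q) z)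
  ∂-chainOf x z adm = lin-mapC (chainOf x) ∂ (barDiff Q) z (All.map (λ {kt} → onBasis (proj₂ kt)) adm)
    where
    onBasis : (t : List (Pt _)) → Admissible x t → ∂ (chainOf x t) ≡ mapC (chainOf x) (barDiff Q t)
    onBasis t a = trans (cong (alt 1#) (interiorFaces-chainOf x t a)) (alt-mapC (chainOf x) 1# (merges mul t))

  barDiff-admissible : (x : Pt n) (z : Comb (List (Pt n))) → All (λ kt → Admissible x (proj₂ kt)) z →
                       All (λ kt → Admissible x (proj₂ kt)) (lin (barDiff Q) z)
  barDiff-admissible x z adm =
    lin-All (barDiff Q) z (All.map (λ {kt} a → alt-All 1# (merges mul (proj₂ kt)) (All.map proj₁ (merges-admissible x _ a))) adm)

  endsAt : Pt n → Pt n → List (Pt n) → Bool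
  endsAt x y t = does (endpoint x t ≟ᵖ y)

  endsAt-complete : (x y : Pt n) (t : List (Pt n)) → endpoint x t ≡ y → endsAt x y t ≡ true
  endsAt-complete x y t = dec-true (endpoint x t ≟ᵖ y)

  endsAt-sound : (x y : Pt n) (t : List (Pt n)) → endsAt x y t ≡ true → endpoint x t ≡ y
  endsAt-sound x y t e with endpoint x t ≟ᵖ y | e
  ... | yes eq | _  = eq
  ... | no _   | ()

  barDiff-preserves-endsAt : (x y : Pt n) (z : Comb (List (Pt n))) → All (λ kt → Admissible x (proj₂ kt)) z →
                             Preserves _≟ᵗ_ (barDiff Q) (endsAt x y) z
  barDiff-preserves-endsAt x y z adm =
    All.map (λ {kt} a → alt-All 1# (merges mul (proj₂ kt))
              (All.map (λ { (_ , same-end) → cong (λ q → does (q ≟ᵖ y)) same-end }) (merges-admissible x _ a))) adm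

  private
    module Relabel {n : ℕ} (x : Pt n) =
      InjectiveRelabelling _≟ᵗ_ _≟ᵗ_ (chainOf x) (Admissible x) (chainOf-injective x)

  bar⇒chain-equation : (x : Pt n) (b z : Comb (List (Pt n))) →
    All (λ kt → Admissible x (proj₂ kt)) b → All (λ kt → Admissible x (proj₂ kt)) z →
    Eqᶜ _≟ᵗ_ (lin (barDiff Q) b) z → Eqᶜ _≟ᵗ_ (lin ∂ (mapC (chainOf x) b)) (mapC (chainOf x) z)
  bar⇒chain-equation x b z adm-b adm-z eq rewrite ∂-chainOf x b adm-b =
    Relabel.mapC-respects x (lin (barDiff Q) b) z (barDiff-admissible x b adm-b) adm-z eq

  chain⇒bar-equation : (x : Pt n) (b z : Comb (List (Pt n))) →
    All (λ kt → Admissible x (proj₂ kt)) b → All (λ kt → Admissible x (proj₂ kt)) z →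
    Eqᶜ _≟ᵗ_ (lin ∂ (mapC (chainOf x) b)) (mapC (chainOf x) z) → Eqᶜ _≟ᵗ_ (lin (barDiff Q) b) z
  chain⇒bar-equation x b z adm-b adm-z eq =
    Relabel.mapC-reflects x (lin (barDiff Q) b) z (barDiff-admissible x b adm-b) adm-z
      (subst (λ w → Eqᶜ _≟ᵗ_ w (mapC (chainOf x) z)) (∂-chainOf x b adm-b) eq)

  walks-admissible : {x y : Pt n} {r : ℕ} (z : Comb (List (Pt n))) → All (λ kt → WalkIn x y r (proj₂ kt)) z →
                     All (λ kt → Admissible x (proj₂ kt)) z
  walks-admissible z = All.map proj₁

  module Interval {n : ℕ} (x w₀ y : Pt n) (d₀ : Disj x w₀) (y≡ : mul x w₀ ≡ y) where

    walk-shape : (t : List (Pt n)) → Admissible x t → endpoint x t ≡ y →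
                 support t ≡ proj₁ w₀ × sum (map degP t) ≡ degP w₀
    walk-shape t a end =
      ∪-cancelˡ (proj₁ x) (support t) (proj₁ w₀) (proj₂ (admissible⇒ x t a)) d₀
        (trans (sym (endpoint-support x t a)) (trans (cong proj₁ ends) (supp-mul x w₀ d₀))) ,
      ℕ.+-cancelˡ-≡ (degP x) _ _ (trans (sym (endpoint-deg x t a)) (trans (cong degP ends) (deg-mul x w₀ d₀)))
      where
      ends : endpoint x t ≡ mul x w₀
      ends = trans end (sym y≡)

    bar-admissible : {d : ℕ} (t : List (Pt n)) → BarBasis Q (proj₁ w₀) d t → Admissible x t
    bar-admissible t ((pw , support≡) , _) = ⇒admissible x t pw (subst (Disjoint (proj₁ x)) (sym support≡) d₀)

    bar⇒walk : {d r : ℕ} (t : List (Pt n)) → BarBasis Q (proj₁ w₀) d t → endpoint x t ≡ y →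
               d + r ≡ degP w₀ → WalkIn x y r t
    bar⇒walk {d} t bar@(_ , positive , sum≡) end d+r≡ =
      a , positive , ℕ.+-cancelˡ-≡ d _ _ (trans (sym sum≡) (trans (proj₂ (walk-shape t a end)) (sym d+r≡))) , end
      where
      a : Admissible x t
      a = bar-admissible t bar

    walk⇒bar : {d r : ℕ} (t : List (Pt n)) → WalkIn x y r t → d + r ≡ degP w₀ → BarBasis Q (proj₁ w₀) d t
    walk⇒bar {d} t (a , positive , length≡ , end) d+r≡ =
      (proj₁ (admissible⇒ x t a) , proj₁ (walk-shape t a end)) , positive ,
      trans (proj₂ (walk-shape t a end)) (trans (sym d+r≡) (cong (d +_) (sym length≡)))

    -- A walk has at most deg w₀ steps, each step having positive degree.
    walk-length≤ : {r : ℕ} (t : List (Pt n)) → WalkIn x y r t → r ≤ degP w₀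
    walk-length≤ t (a , positive , length≡ , end) =
      subst (_≤ degP w₀) length≡ (subst (length t ≤_) (proj₂ (walk-shape t a end)) (length≤sum t positive))

-- Koszul ⇒ Cohen–Macaulay: a cycle of chains of length r in [x, x·w₀] is a
-- bar cycle on supp w₀ of degree deg w₀ - r; Koszulness bounds it in Bar, and
-- restricting the bounding chain to walks ending at x·w₀ bounds it in [x, x·w₀].
module KoszulImpliesCohenMacaulay {c ℓ : Level} (K : Field c ℓ) (M : CMonoid) (Q : Quad.Quadratic K M) where
  open Field K using (_≈_) renaming (refl to ≈-refl)
  open CMonoid M
  open CM M
  open Quad K M
  open Quadratic Q
  open Lin K
  open MoebiusCM K M
  open LinearCombinations K
  open PointMonoid M
  open Walks K M
  open QuadraticIntervals K M Q
  open BarVersusChains K M Q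

  private variable n : ℕ

  boundary-below-rank : Koszul Q → (x w₀ : Pt n) (d₀ : Disj x w₀) (r kk : ℕ) → suc kk + r ≡ degP w₀ →
    (z : Comb (List (Pt n))) → All (λ kt → WalkIn x (mul x w₀) r (proj₂ kt)) z →
    Eqᶜ _≟ᵗ_ (lin ∂ (mapC (chainOf x) z)) [] →
    Σ (Comb (List (Pt n))) λ b → All (λ kt → ChainIn x (mul x w₀) (suc r) (proj₂ kt)) b ×
                                 Eqᶜ _≟ᵗ_ (lin ∂ b) (mapC (chainOf x) z)
  boundary-below-rank kos x w₀ d₀ r kk deg≡ z walks cycle =
    mapC (chainOf x) b , walks⇒chains x y (suc r) b b-walks ,
    bar⇒chain-equation x b z (walks-admissible b b-walks) (walks-admissible z walks) b-bounds
    where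
    open Interval x w₀ (mul x w₀) d₀ refl
    y : Pt _
    y = mul x w₀
    bar-cycle : Eqᶜ _≟ᵗ_ (lin (barDiff Q) z) []
    bar-cycle = chain⇒bar-equation x z [] (walks-admissible z walks) [] cycle
    koszul : Σ (Comb (List (Pt _))) λ bb → All (λ kt → BarBasis Q (proj₁ w₀) kk (proj₂ kt)) bb ×
                                           Eqᶜ _≟ᵗ_ (lin (barDiff Q) bb) z
    koszul = kos (proj₁ w₀) kk z (All.map (λ {kt} w → walk⇒bar (proj₂ kt) w deg≡) walks) bar-cycle
    b : Comb (List (Pt _))
    b = restrict _≟ᵗ_ (endsAt x y) (proj₁ koszul)
    b-walks : All (λ kt → WalkIn x y (suc r) (proj₂ kt)) b
    b-walks = All.map (λ {kt} (bar , ends) → bar⇒walk (proj₂ kt) bar (endsAt-sound x y (proj₂ kt) ends) (trans (ℕ.+-suc kk r) deg≡))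
                      (restrict-All _≟ᵗ_ (endsAt x y) (proj₁ koszul) (proj₁ (proj₂ koszul)))
    b-bounds : Eqᶜ _≟ᵗ_ (lin (barDiff Q) b) z
    b-bounds = restrict-boundary _≟ᵗ_ (endsAt x y) (barDiff Q) (proj₁ koszul) z
      (barDiff-preserves-endsAt x y _ (All.map (λ {kt} → bar-admissible (proj₂ kt)) (proj₁ (proj₂ koszul))))
      (All.map (λ {kt} w → endsAt-complete x y (proj₂ kt) (proj₂ (proj₂ (proj₂ w)))) walks)
      (proj₂ (proj₂ koszul))

  no-chains-above-rank : (x w₀ : Pt n) (d₀ : Disj x w₀) (r : ℕ) → degP w₀ < r →
    (z : Comb (List (Pt n))) → All (λ kt → WalkIn x (mul x w₀) r (proj₂ kt)) z →
    Eqᶜ _≟ᵗ_ [] (mapC (chainOf x) z)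
  no-chains-above-rank x w₀ d₀ r deg<r []            []       _ = ≈-refl
  no-chains-above-rank x w₀ d₀ r deg<r ((_ , t) ∷ _) (w ∷ _)  _ =
    ⊥-elim (ℕ.<⇒≱ deg<r (Interval.walk-length≤ x w₀ (mul x w₀) d₀ refl t w))

  homology-vanishes : Koszul Q → (x y : Pt n) → x ≤ν y → ∀ r → r ≢ degP y ∸ degP x → HomologyVanishes x y r
  homology-vanishes kos x y x≤y r r≢rank z chains cycle with ≤ν⇒factor x y x≤y
  ... | w₀ , d₀ , refl with chains⇒walks x (mul x w₀) r z chains
  ... | z′ , walks , refl with ℕ.<-cmp r (degP w₀)
  ... | tri< r<deg _ _ = boundary-below-rank kos x w₀ d₀ r (degP w₀ ∸ suc r)
                           (trans (sym (ℕ.+-suc _ r)) (ℕ.m∸n+n≡m r<deg)) z′ walks cycle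
  ... | tri≈ _ r≡deg _ = ⊥-elim (r≢rank (trans r≡deg (sym rank≡)))
    where
    rank≡ : degP (mul x w₀) ∸ degP x ≡ degP w₀
    rank≡ = trans (cong (_∸ degP x) (deg-mul x w₀ d₀)) (ℕ.m+n∸m≡n (degP x) (degP w₀))
  ... | tri> _ _ deg<r = [] , [] , no-chains-above-rank x w₀ d₀ r deg<r z′ walks

  koszul⇒cohenMacaulay : Koszul Q → CohenMacaulay
  koszul⇒cohenMacaulay kos U m x y _ x≤y _ = degP y ∸ degP x , interval-graded x y , homology-vanishes kos x y x≤y

-- Cohen–Macaulay ⇒ Koszul: a bar cycle on U splits by the endpoint y of its
-- walks from 0̂; the part ending at y is a cycle of chains of [0̂, y] of length
-- deg y - d ≠ rk [0̂, y], hence a boundary there, hence a bar boundary.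
module CohenMacaulayImpliesKoszul {c ℓ : Level} (K : Field c ℓ) (M : CMonoid) (Q : Quad.Quadratic K M) where
  open Field K using (_≈_) renaming (refl to ≈-refl)
  open CMonoid M
  open CM M
  open Quad K M
  open Quadratic Q
  open Lin K
  open MoebiusCM K M
  open LinearCombinations K
  open PointMonoid M
  open Walks K M
  open QuadraticIntervals K M Q
  open BarVersusChains K M Q

  private variable n : ℕ

  -- [0̂, y] has rank deg y, so Cohen–Macaulayness kills its homology off deg y.
  interval-homology : CohenMacaulay → (y : Pt n) (r : ℕ) → r ≢ degP y → HomologyVanishes 0̂ y r
  interval-homology cm y r r≢deg with cm (proj₁ y) (proj₂ y) 0̂ y (≤ν-refl 0̂) (0̂-least y) (≤ν-refl y)
  ... | ρ , graded , vanishes =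
    vanishes r (λ r≡ρ → r≢deg (trans r≡ρ (sym (graded (degP y) _ (proj₂ (maximal-chain y))))))

  cycle-at-endpoint : CohenMacaulay → (y : Pt n) (kk : ℕ) → suc kk ≤ degP y →
    (z : Comb (List (Pt n))) →
    All (λ kt → BarBasis Q (proj₁ y) (suc kk) (proj₂ kt) × endpoint 0̂ (proj₂ kt) ≡ y) z →
    Eqᶜ _≟ᵗ_ (lin (barDiff Q) z) [] →
    Σ (Comb (List (Pt n))) λ b → All (λ kt → BarBasis Q (proj₁ y) kk (proj₂ kt)) b × Eqᶜ _≟ᵗ_ (lin (barDiff Q) b) z
  cycle-at-endpoint cm y kk kk<deg z bars cycle =
    pull-back (interval-homology cm y r r≢deg (mapC (chainOf 0̂) z) (walks⇒chains 0̂ y r z walks)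
                (bar⇒chain-equation 0̂ z [] (walks-admissible z walks) [] cycle))
    where
    open Interval 0̂ y y (∩-zeroˡ (proj₁ y)) (mul-identityˡ y)
    r : ℕ
    r = degP y ∸ suc kk
    deg-split : suc kk + r ≡ degP y
    deg-split = ℕ.m+[n∸m]≡n kk<deg
    r≢deg : r ≢ degP y
    r≢deg r≡deg = ℕ.m≢1+n+m (degP y) (trans (sym deg-split) (cong (suc kk +_) r≡deg))
    walks : All (λ kt → WalkIn 0̂ y r (proj₂ kt)) z
    walks = All.map (λ {kt} (bar , ends) → bar⇒walk (proj₂ kt) bar ends deg-split) bars
    pull-back : Σ (Comb (List (Pt _))) (λ bc → All (λ kt → ChainIn 0̂ y (suc r) (proj₂ kt)) bc ×
                                                Eqᶜ _≟ᵗ_ (lin ∂ bc) (mapC (chainOf 0̂) z)) →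
                Σ (Comb (List (Pt _))) λ b → All (λ kt → BarBasis Q (proj₁ y) kk (proj₂ kt)) b ×
                                             Eqᶜ _≟ᵗ_ (lin (barDiff Q) b) z
    pull-back (bc , chains , bc-bounds) with chains⇒walks 0̂ y (suc r) bc chains
    ... | b , b-walks , refl =
      b , All.map (λ {kt} w → walk⇒bar (proj₂ kt) w (trans (ℕ.+-suc kk r) deg-split)) b-walks ,
      chain⇒bar-equation 0̂ b z (walks-admissible b b-walks) (walks-admissible z walks) bc-bounds

  bar-endpoint : {U : Subset n} {d : ℕ} (t : List (Pt n)) → BarBasis Q U d t →
                 Admissible 0̂ t × proj₁ (endpoint 0̂ t) ≡ U × degP (endpoint 0̂ t) ≡ d + length t
  bar-endpoint t ((pw , support≡) , _ , sum≡) =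
    a , trans (endpoint-support 0̂ t a) (trans (∪-identityˡ (support t)) support≡) ,
    trans (endpoint-deg 0̂ t a) (trans (cong (_+ sum (map degP t)) deg-e) sum≡)
    where
    a : Admissible 0̂ t
    a = ⇒admissible 0̂ t pw (∩-zeroˡ _)

  -- Bar cycles whose walks from 0̂ end in the list L are bar boundaries: split
  -- off the part ending at the head of L and recurse on the rest.
  cycles-by-endpoints : CohenMacaulay → (U : Subset n) (kk : ℕ) (L : List (Pt n)) →
    All (λ y → proj₁ y ≡ U × suc kk ≤ degP y) L →
    (z : Comb (List (Pt n))) → All (λ kt → BarBasis Q U (suc kk) (proj₂ kt) × endpoint 0̂ (proj₂ kt) ∈ L) z →
    Eqᶜ _≟ᵗ_ (lin (barDiff Q) z) [] →
    Σ (Comb (List (Pt n))) λ b → All (λ kt → BarBasis Q U kk (proj₂ kt)) b × Eqᶜ _≟ᵗ_ (lin (barDiff Q) b) z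
  cycles-by-endpoints cm U kk []      _                      []      []             _     = [] , [] , λ _ → ≈-refl
  cycles-by-endpoints cm U kk []      _                      (_ ∷ _) ((_ , ()) ∷ _) _
  cycles-by-endpoints cm U kk (y ∷ L) ((refl , kk<deg) ∷ ys) z       bars           cycle =
    proj₁ at-y ++ proj₁ elsewhere , ++⁺ (proj₁ (proj₂ at-y)) (proj₁ (proj₂ elsewhere)) ,
    boundary-of-split _≟ᵗ_ (endsAt 0̂ y) (barDiff Q) (proj₁ at-y) (proj₁ elsewhere) z
      (proj₂ (proj₂ at-y)) (proj₂ (proj₂ elsewhere))
    where
    pres : Preserves _≟ᵗ_ (barDiff Q) (endsAt 0̂ y) z
    pres = barDiff-preserves-endsAt 0̂ y z (All.map (λ {kt} (bar , _) → proj₁ (bar-endpoint (proj₂ kt) bar)) bars)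
    at-y : Σ (Comb (List (Pt _))) λ b → All (λ kt → BarBasis Q U kk (proj₂ kt)) b ×
                                       Eqᶜ _≟ᵗ_ (lin (barDiff Q) b) (restrict _≟ᵗ_ (endsAt 0̂ y) z)
    at-y = cycle-at-endpoint cm y kk kk<deg (restrict _≟ᵗ_ (endsAt 0̂ y) z)
      (All.map (λ {kt} ((bar , _) , ends) → bar , endsAt-sound 0̂ y (proj₂ kt) ends) (restrict-All _≟ᵗ_ (endsAt 0̂ y) z bars))
      (restrict-boundary _≟ᵗ_ (endsAt 0̂ y) (barDiff Q) z [] pres [] cycle)
    elsewhere-in-L : (t : List (Pt _)) → endpoint 0̂ t ∈ (y ∷ L) → not (endsAt 0̂ y t) ≡ true → endpoint 0̂ t ∈ L
    elsewhere-in-L t (here ends) not-y = ⊥-elim (not-¬ (sym (endsAt-complete 0̂ y t ends)) (sym not-y))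
    elsewhere-in-L t (there ∈L)  _     = ∈L
    elsewhere : Σ (Comb (List (Pt _))) λ b → All (λ kt → BarBasis Q U kk (proj₂ kt)) b ×
                                            Eqᶜ _≟ᵗ_ (lin (barDiff Q) b) (restrict _≟ᵗ_ (λ t → not (endsAt 0̂ y t)) z)
    elsewhere = cycles-by-endpoints cm U kk L ys (restrict _≟ᵗ_ (λ t → not (endsAt 0̂ y t)) z)
      (All.map (λ {kt} ((bar , ∈yL) , not-y) → bar , elsewhere-in-L (proj₂ kt) ∈yL not-y)
               (restrict-All _≟ᵗ_ (λ t → not (endsAt 0̂ y t)) z bars))
      (restrict-boundary _≟ᵗ_ _ (barDiff Q) z [] (Preserves-not _≟ᵗ_ (barDiff Q) (endsAt 0̂ y) z pres) [] cycle)

  cohenMacaulay⇒koszul : CohenMacaulay → Koszul Q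
  cohenMacaulay⇒koszul cm U kk z bars cycle =
    cycles-by-endpoints cm U kk (map endpoint₀ z) (map⁺ (All.map (λ {kt} → shape (proj₂ kt)) bars)) z
      (All.zip (bars , All.tabulate (∈-map⁺ endpoint₀))) cycle
    where
    endpoint₀ : Σ _ (λ _ → List (Pt _)) → Pt _
    endpoint₀ kt = endpoint 0̂ (proj₂ kt)
    shape : (t : List (Pt _)) → BarBasis Q U (suc kk) t → proj₁ (endpoint 0̂ t) ≡ U × suc kk ≤ degP (endpoint 0̂ t)
    shape t bar with bar-endpoint t bar
    ... | _ , support≡ , deg≡ = support≡ , ℕ.≤-trans (ℕ.m≤m+n (suc kk) (length t)) (ℕ.≤-reflexive (sym deg≡))

mainTheorem11 : ∀ {c ℓ} (K : Field c ℓ) → CharZero K →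
    (M : CMonoid) (Q : Quad.Quadratic K M) →
    (Quad.Koszul K M Q ⇔ MoebiusCM.CohenMacaulay K M)
mainTheorem11 K _ M Q =
  mk⇔ (KoszulImpliesCohenMacaulay.koszul⇒cohenMacaulay K M Q)
      (CohenMacaulayImpliesKoszul.cohenMacaulay⇒koszul K M Q)
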